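{- Let $d\ge 3$. Let $G_d$ be the graph with vertex set $H_d$ in which two distinct vertices $a,b\in H_d$ are adjacent if and only if $a-b\in H_d$ or $b-a\in H_d$. Let $Cr(2d)$ be the crown graph on $2d$ vertices, i.e. the complete bipartite graph $K_{d,d}$ with the edges of a perfect matching removed. Then $G_d$ is isomorphic to the line graph $L(Cr(2d))$.
   Context: $H_d$ is the set of vectors in $\mathbb{R}^d$ having exactly one coordinate equal to $1$, exactly one coordinate equal to $-1$, and all other coordinates equal to $0$. -}

module Defs where

open import Data.Nat using (ℕ; _≤_; _+_)
open import Data.Integer using (ℤ; _-_; 1ℤ; -1ℤ; 0ℤ)
open import Data.Fin using (Fin; toℕ; splitAt) renaming (_<_ to _<ᶠ_)
open import Data.Vec using (Vec; zipWith; lookup; count)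
open import Data.Vec.Relation.Unary.All using (All)
open import Data.Product using (Σ; _×_; _,_; proj₁)
open import Data.Sum using (_⊎_; inj₁; inj₂)
open import Data.Empty using (⊥)
open import Data.Bool using (Bool; T)
open import Relation.Nullary using (¬_)
open import Relation.Binary.PropositionalEquality using (_≡_; _≢_)
open import Function.Bundles using (_↔_; Inverse; _⇔_)
open import Level using (0ℓ)
import Data.Integer.Properties as ℤP

record Graph : Set₁ where
  field
    V   : Set
    Adj : V → V → Set

open Graph public

_≅_ : Graph → Graph → Set
G ≅ H = Σ (V G ↔ V H) λ f →
          ∀ a b → Adj G a b ⇔ Adj H (Inverse.to f a) (Inverse.to f b)

IsH : ∀ {d} → Vec ℤ d → Set
IsH v = (count (ℤP._≟ 1ℤ) v ≡ 1)
      × (count (ℤP._≟ -1ℤ) v ≡ 1)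
      × All (λ x → x ≡ 1ℤ ⊎ x ≡ -1ℤ ⊎ x ≡ 0ℤ) v

H : ℕ → Set
H d = Σ (Vec ℤ d) IsH

_-ᵥ_ : ∀ {d} → Vec ℤ d → Vec ℤ d → Vec ℤ d
a -ᵥ b = zipWith _-_ a b

G : ℕ → Graph
G d = record
  { V   = H d
  ; Adj = λ a b → (a ≢ b) × (IsH (proj₁ a -ᵥ proj₁ b) ⊎ IsH (proj₁ b -ᵥ proj₁ a))
  }

-- Line graph of a graph on vertex set Fin n.
-- Edges are represented as pairs (x , y) with x < y and x adjacent to y;
-- two edges are adjacent iff they are distinct and share an endpoint.

Edge : ∀ {n} → (Fin n → Fin n → Set) → Set
Edge {n} A = Σ (Fin n) λ x → Σ (Fin n) λ y → (x <ᶠ y) × A x y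

src tgt : ∀ {n} {A : Fin n → Fin n → Set} → Edge A → Fin n
src (x , _ , _) = x
tgt (_ , y , _) = y

ShareEndpoint : ∀ {n} {A : Fin n → Fin n → Set} → Edge A → Edge A → Set
ShareEndpoint e f = src e ≡ src f ⊎ src e ≡ tgt f ⊎ tgt e ≡ src f ⊎ tgt e ≡ tgt f

LineGraph : (n : ℕ) → (Fin n → Fin n → Set) → Graph
LineGraph n A = record
  { V   = Edge A
  ; Adj = λ e f → (e ≢ f) × ShareEndpoint e f
  }

-- Crown graph Cr(2d) on vertex set Fin (d + d): vertex k lies on side
-- splitAt d k (inj₁ i = u_i, inj₂ j = v_j); u_i ~ v_j iff i ≠ j, i.e.
-- K_{d,d} minus the perfect matching {u_i v_i}.

CrownAdj′ : ∀ {d} → Fin d ⊎ Fin d → Fin d ⊎ Fin d → Set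
CrownAdj′ (inj₁ i) (inj₂ j) = i ≢ j
CrownAdj′ (inj₂ j) (inj₁ i) = i ≢ j
CrownAdj′ (inj₁ _) (inj₁ _) = ⊥
CrownAdj′ (inj₂ _) (inj₂ _) = ⊥

CrownAdj : (d : ℕ) → Fin (d + d) → Fin (d + d) → Set
CrownAdj d x y = CrownAdj′ (splitAt d x) (splitAt d y)

Crown : ℕ → Graph
Crown d = record { V = Fin (d + d) ; Adj = CrownAdj d }

LineCrown : ℕ → Graph
LineCrown d = LineGraph (d + d) (CrownAdj d)

-- Both graphs are the rook's graph on the off-diagonal cells (i , j), i ≠ j, of a
-- d × d board, two cells being adjacent when they share a row or a column.
-- Every vector of H_d is e_i − e_j for a unique such cell, and for distinct cells
-- (e_i − e_j) − (e_k − e_l) lies in H_d exactly when i = k or j = l: otherwise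
-- some coordinate is ±2, or the coordinates j and k are both −1.
-- Every edge of the crown is u_i v_j for a unique such cell, and two of them
-- meet exactly when they share i or j.

module Submission where

open import Defs
open import Data.Nat using (ℕ; _≤_; _+_; suc)
import Data.Nat.Properties as ℕ
open import Data.Integer using (ℤ; _-_; 1ℤ; -1ℤ; 0ℤ; +_; -[1+_])
import Data.Integer.Properties as ℤ
open import Data.Fin using (Fin; zero; suc; toℕ; splitAt; _↑ˡ_; _↑ʳ_; _≟_) renaming (_<_ to _<ᶠ_)
open import Data.Fin.Properties
  using (0≢1+n; suc-injective; toℕ<n; toℕ-↑ˡ; toℕ-↑ʳ; ↑ˡ-injective; ↑ʳ-injective;
         splitAt-↑ˡ; splitAt-↑ʳ; splitAt⁻¹-↑ˡ; splitAt⁻¹-↑ʳ; <-irrelevant; <-irrefl; <-asym)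
open import Data.Vec using (Vec; []; _∷_; lookup; count; tabulate)
open import Data.Vec.Properties using (lookup∘tabulate; tabulate∘lookup; tabulate-cong; lookup-zipWith)
import Data.Vec.Relation.Unary.All as All
open import Data.Vec.Relation.Unary.All.Properties using (lookup⁺; tabulate⁺)
open import Data.Product using (Σ-syntax; ∃!; _×_; _,_; proj₁)
open import Data.Sum using (_⊎_; inj₁; inj₂; [_,_]) renaming (map to map-⊎)
open import Data.Empty using (⊥-elim)
open import Function using (_∘_)
open import Function.Bundles using (_↔_; Inverse; Injection; _⇔_; Equivalence; mk⇔; mk↔ₛ′)
open import Function.Properties.Inverse using (Inverse⇒Injection)
open import Function.Construct.Composition using (_↔-∘_; _⇔-∘_)
open import Function.Construct.Symmetry using (↔-sym; ⇔-sym)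
open import Relation.Nullary using (¬_; yes; no; Irrelevant)
open import Relation.Unary using (Decidable)
open import Relation.Binary.PropositionalEquality
  using (_≡_; _≢_; refl; sym; trans; cong; cong₂; subst; subst₂; module ≡-Reasoning)

module _ {A : Set} {P : A → Set} (P? : Decidable P) where

  count≡0⇒¬P : ∀ {n} (v : Vec A n) → count P? v ≡ 0 → ∀ k → ¬ P (lookup v k)
  count≡0⇒¬P (x ∷ v) eq k with P? x
  count≡0⇒¬P (x ∷ v) () k       | yes _
  count≡0⇒¬P (x ∷ v) eq zero    | no ¬px = ¬px
  count≡0⇒¬P (x ∷ v) eq (suc k) | no _   = count≡0⇒¬P v eq k

  ¬P⇒count≡0 : ∀ {n} (v : Vec A n) → (∀ k → ¬ P (lookup v k)) → count P? v ≡ 0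
  ¬P⇒count≡0 []      _  = refl
  ¬P⇒count≡0 (x ∷ v) ¬P with P? x
  ... | yes px = ⊥-elim (¬P zero px)
  ... | no _   = ¬P⇒count≡0 v (¬P ∘ suc)

  count≡1⇒∃! : ∀ {n} (v : Vec A n) → count P? v ≡ 1 → ∃! _≡_ (P ∘ lookup v)
  count≡1⇒∃! (x ∷ v) eq with P? x
  ... | yes px = zero , px , λ
    { {zero}  _  → refl
    ; {suc k} pk → ⊥-elim (count≡0⇒¬P v (ℕ.suc-injective eq) k pk) }
  ... | no ¬px with count≡1⇒∃! v eq
  ...   | i , pi , unique = suc i , pi , λ
    { {zero}  px → ⊥-elim (¬px px)
    ; {suc k} pk → cong suc (unique pk) }

  ∃!⇒count≡1 : ∀ {n} (v : Vec A n) → ∃! _≡_ (P ∘ lookup v) → count P? v ≡ 1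
  ∃!⇒count≡1 (x ∷ v) (i , pi , unique) with P? x
  ∃!⇒count≡1 (x ∷ v) (i , pi , unique) | yes px =
    cong suc (¬P⇒count≡0 v λ k pk → 0≢1+n (trans (sym (unique px)) (unique pk)))
  ∃!⇒count≡1 (x ∷ v) (zero  , px , _)      | no ¬px = ⊥-elim (¬px px)
  ∃!⇒count≡1 (x ∷ v) (suc i , pi , unique) | no _   =
    ∃!⇒count≡1 v (i , pi , suc-injective ∘ unique)

lookup-extensionality : ∀ {A : Set} {n} {u v : Vec A n} →
                        (∀ k → lookup u k ≡ lookup v k) → u ≡ v
lookup-extensionality {u = u} {v} eq =
  trans (sym (tabulate∘lookup u)) (trans (tabulate-cong eq) (tabulate∘lookup v))

≅-sym : ∀ {Γ Δ} → Γ ≅ Δ → Δ ≅ Γ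
≅-sym {Γ} {Δ} (f , adj) = ↔-sym f , λ a b →
  subst₂ (λ x y → Adj Δ x y ⇔ Adj Γ (from a) (from b))
         (strictlyInverseˡ a) (strictlyInverseˡ b) (⇔-sym (adj (from a) (from b)))
  where open Inverse f

≅-trans : ∀ {Γ Δ Θ} → Γ ≅ Δ → Δ ≅ Θ → Γ ≅ Θ
≅-trans (f , adj-f) (g , adj-g) = g ↔-∘ f , λ a b → adj-g _ _ ⇔-∘ adj-f a b

module _ {A B : Set} (f : A ↔ B) where
  open Inverse f

  distinct×⇔ : {P : A → A → Set} {Q : B → B → Set} →
               (∀ {a b} → a ≢ b → P a b ⇔ Q (to a) (to b)) →
               ∀ a b → (a ≢ b × P a b) ⇔ (to a ≢ to b × Q (to a) (to b))
  distinct×⇔ P⇔Q a b = mk⇔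
    (λ (a≢b , p) → a≢b ∘ Injection.injective (Inverse⇒Injection f)
                 , Equivalence.to (P⇔Q a≢b) p)
    (λ (ta≢tb , q) → ta≢tb ∘ cong to , Equivalence.from (P⇔Q (ta≢tb ∘ cong to)) q)

OffDiagonal : ℕ → Set
OffDiagonal d = Σ[ i ∈ Fin d ] Σ[ j ∈ Fin d ] i ≢ j

-- Proofs of i ≢ j are judgementally equal: ⊥ is a record with an irrelevant field.
OffDiagonal-≡ : ∀ {d} {i j k l : Fin d} {i≢j : i ≢ j} {k≢l : k ≢ l} →
                i ≡ k → j ≡ l → (i , j , i≢j) ≡ (k , l , k≢l)
OffDiagonal-≡ refl refl = refl

SameLine : ∀ {d} → OffDiagonal d → OffDiagonal d → Set
SameLine (i , j , _) (k , l , _) = i ≡ k ⊎ j ≡ l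

Rook : ℕ → Graph
Rook d = record { V = OffDiagonal d ; Adj = λ p q → p ≢ q × SameLine p q }

Trit : ℤ → Set
Trit x = x ≡ 1ℤ ⊎ x ≡ -1ℤ ⊎ x ≡ 0ℤ

Trit-irrelevant : ∀ {x} → Irrelevant (Trit x)
Trit-irrelevant (inj₁ refl)        (inj₁ refl)        = refl
Trit-irrelevant (inj₂ (inj₁ refl)) (inj₂ (inj₁ refl)) = refl
Trit-irrelevant (inj₂ (inj₂ refl)) (inj₂ (inj₂ refl)) = refl
Trit-irrelevant (inj₁ refl)        (inj₂ (inj₁ ()))
Trit-irrelevant (inj₁ refl)        (inj₂ (inj₂ ()))
Trit-irrelevant (inj₂ (inj₁ refl)) (inj₁ ())
Trit-irrelevant (inj₂ (inj₁ refl)) (inj₂ (inj₂ ()))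
Trit-irrelevant (inj₂ (inj₂ refl)) (inj₁ ())
Trit-irrelevant (inj₂ (inj₂ refl)) (inj₂ (inj₁ ()))

¬Trit[+2] : ¬ Trit (+ 2)
¬Trit[+2] (inj₁ ())
¬Trit[+2] (inj₂ (inj₁ ()))
¬Trit[+2] (inj₂ (inj₂ ()))

¬Trit[-2] : ¬ Trit -[1+ 1 ]
¬Trit[-2] (inj₁ ())
¬Trit[-2] (inj₂ (inj₁ ()))
¬Trit[-2] (inj₂ (inj₂ ()))

IsH-irrelevant : ∀ {d} {v : Vec ℤ d} → Irrelevant (IsH v)
IsH-irrelevant (ones , minus-ones , trits) (ones′ , minus-ones′ , trits′) =
  cong₂ _,_ (ℕ.≡-irrelevant ones ones′)
            (cong₂ _,_ (ℕ.≡-irrelevant minus-ones minus-ones′)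
                       (All.irrelevant Trit-irrelevant trits trits′))

H-≡ : ∀ {d} {a b : H d} → proj₁ a ≡ proj₁ b → a ≡ b
H-≡ {a = v , p} {.v , q} refl = cong (v ,_) (IsH-irrelevant p q)

module _ {d : ℕ} where

  coord : Fin d → Fin d → Fin d → ℤ
  coord i j k with k ≟ i | k ≟ j
  ... | yes _ | _     = 1ℤ
  ... | no _  | yes _ = -1ℤ
  ... | no _  | no _  = 0ℤ

  e : Fin d → Fin d → Vec ℤ d
  e i j = tabulate (coord i j)

  e-row : ∀ i j → lookup (e i j) i ≡ 1ℤ
  e-row i j rewrite lookup∘tabulate (coord i j) i with i ≟ i
  ... | yes _   = refl
  ... | no i≢i = ⊥-elim (i≢i refl)

  e-col : ∀ {i j} → i ≢ j → lookup (e i j) j ≡ -1ℤ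
  e-col {i} {j} i≢j rewrite lookup∘tabulate (coord i j) j with j ≟ i | j ≟ j
  ... | yes j≡i | _       = ⊥-elim (i≢j (sym j≡i))
  ... | no _    | yes _   = refl
  ... | no _    | no j≢j  = ⊥-elim (j≢j refl)

  e-elsewhere : ∀ {i j k} → k ≢ i → k ≢ j → lookup (e i j) k ≡ 0ℤ
  e-elsewhere {i} {j} {k} k≢i k≢j
    rewrite lookup∘tabulate (coord i j) k with k ≟ i | k ≟ j
  ... | yes k≡i | _       = ⊥-elim (k≢i k≡i)
  ... | no _    | yes k≡j = ⊥-elim (k≢j k≡j)
  ... | no _    | no _    = refl

  e≡1⇒row : ∀ {i j k} → lookup (e i j) k ≡ 1ℤ → k ≡ i
  e≡1⇒row {i} {j} {k} eq rewrite lookup∘tabulate (coord i j) k with k ≟ i | k ≟ j | eq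
  ... | yes k≡i | _     | _  = k≡i
  ... | no _    | yes _ | ()
  ... | no _    | no _  | ()

  e≡-1⇒col : ∀ {i j k} → lookup (e i j) k ≡ -1ℤ → k ≡ j
  e≡-1⇒col {i} {j} {k} eq rewrite lookup∘tabulate (coord i j) k with k ≟ i | k ≟ j | eq
  ... | yes _ | _       | ()
  ... | no _  | yes k≡j | _  = k≡j
  ... | no _  | no _    | ()

  coord-Trit : ∀ i j k → Trit (coord i j k)
  coord-Trit i j k with k ≟ i | k ≟ j
  ... | yes _ | _     = inj₁ refl
  ... | no _  | yes _ = inj₂ (inj₁ refl)
  ... | no _  | no _  = inj₂ (inj₂ refl)

  IsH-e : ∀ {i j} → i ≢ j → IsH (e i j)
  IsH-e {i} {j} i≢j =
      ∃!⇒count≡1 (ℤ._≟ 1ℤ) (e i j) (i , e-row i j , sym ∘ e≡1⇒row)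
    , ∃!⇒count≡1 (ℤ._≟ -1ℤ) (e i j) (j , e-col i≢j , sym ∘ e≡-1⇒col)
    , tabulate⁺ (coord-Trit i j)

  IsH⇒≡e : ∀ {v : Vec ℤ d} → IsH v → Σ[ i ∈ Fin d ] Σ[ j ∈ Fin d ] i ≢ j × v ≡ e i j
  IsH⇒≡e {v} (ones , minus-ones , trits)
    with count≡1⇒∃! (ℤ._≟ 1ℤ) v ones | count≡1⇒∃! (ℤ._≟ -1ℤ) v minus-ones
  ... | i , vᵢ≡1 , only-i | j , vⱼ≡-1 , only-j =
    i , j , i≢j , lookup-extensionality entry
    where
    i≢j : i ≢ j
    i≢j refl with () ← trans (sym vᵢ≡1) vⱼ≡-1

    entry : ∀ k → lookup v k ≡ lookup (e i j) k
    entry k with lookup⁺ trits k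
    ... | inj₁ vₖ≡1 with refl ← only-i vₖ≡1 = trans vₖ≡1 (sym (e-row i j))
    ... | inj₂ (inj₁ vₖ≡-1) with refl ← only-j vₖ≡-1 = trans vₖ≡-1 (sym (e-col i≢j))
    ... | inj₂ (inj₂ vₖ≡0) = trans vₖ≡0 (sym (e-elsewhere k≢i k≢j))
      where
      k≢i : k ≢ i
      k≢i refl with () ← trans (sym vₖ≡0) vᵢ≡1
      k≢j : k ≢ j
      k≢j refl with () ← trans (sym vₖ≡0) vⱼ≡-1

  e-injective : ∀ {i j k l} → i ≢ j → e i j ≡ e k l → i ≡ k × j ≡ l
  e-injective {i} {j} i≢j eq =
      e≡1⇒row (subst (λ v → lookup v i ≡ 1ℤ) eq (e-row i j))
    , e≡-1⇒col (subst (λ v → lookup v j ≡ -1ℤ) eq (e-col i≢j))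

  lookup-e-e : ∀ i j k l m → lookup (e i j -ᵥ e k l) m ≡ lookup (e i j) m - lookup (e k l) m
  lookup-e-e i j k l m = lookup-zipWith _-_ m (e i j) (e k l)

  e-e≡e : ∀ {i j k l p q} → (∀ m → coord i j m - coord k l m ≡ coord p q m) →
          e i j -ᵥ e k l ≡ e p q
  e-e≡e {i} {j} {k} {l} {p} {q} pointwise = lookup-extensionality λ m → begin
    lookup (e i j -ᵥ e k l) m            ≡⟨ lookup-e-e i j k l m ⟩
    lookup (e i j) m - lookup (e k l) m  ≡⟨ cong₂ _-_ (lookup∘tabulate _ m) (lookup∘tabulate _ m) ⟩
    coord i j m - coord k l m            ≡⟨ pointwise m ⟩
    coord p q m                          ≡⟨ lookup∘tabulate _ m ⟨
    lookup (e p q) m                     ∎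
    where open ≡-Reasoning

  e-e-sameRow : ∀ {i j l} → i ≢ j → i ≢ l → l ≢ j → e i j -ᵥ e i l ≡ e l j
  e-e-sameRow {i} {j} {l} i≢j i≢l l≢j = e-e≡e pointwise
    where
    pointwise : ∀ m → coord i j m - coord i l m ≡ coord l j m
    pointwise m with m ≟ i | m ≟ j | m ≟ l
    ... | yes refl | yes m≡j  | _        = ⊥-elim (i≢j m≡j)
    ... | yes refl | no _     | yes m≡l  = ⊥-elim (i≢l m≡l)
    ... | yes _    | no _     | no _     = refl
    ... | no _     | yes refl | yes refl = ⊥-elim (l≢j refl)
    ... | no _     | yes _    | no _     = refl
    ... | no _     | no _     | yes _    = refl
    ... | no _     | no _     | no _     = refl

  e-e-sameCol : ∀ {i j k} → i ≢ j → i ≢ k → k ≢ j → e i j -ᵥ e k j ≡ e i k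
  e-e-sameCol {i} {j} {k} i≢j i≢k k≢j = e-e≡e pointwise
    where
    pointwise : ∀ m → coord i j m - coord k j m ≡ coord i k m
    pointwise m with m ≟ i | m ≟ j | m ≟ k
    ... | yes refl | yes m≡j  | _        = ⊥-elim (i≢j m≡j)
    ... | yes refl | no _     | yes m≡k  = ⊥-elim (i≢k m≡k)
    ... | yes _    | no _     | no _     = refl
    ... | no _     | yes refl | yes refl = ⊥-elim (k≢j refl)
    ... | no _     | yes _    | no _     = refl
    ... | no _     | no _     | yes _    = refl
    ... | no _     | no _     | no _     = refl

  ¬IsH-e-e : ∀ {i j k l} → i ≢ j → k ≢ l → i ≢ k → j ≢ l → ¬ IsH (e i j -ᵥ e k l)
  ¬IsH-e-e {i} {j} {k} {l} i≢j k≢l i≢k j≢l (_ , minus-ones , trits) with i ≟ l | j ≟ k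
  ... | yes refl | _ = ¬Trit[+2] (subst Trit vᵢ≡2 (lookup⁺ trits i))
    where
    vᵢ≡2 : lookup (e i j -ᵥ e k i) i ≡ + 2
    vᵢ≡2 = trans (lookup-e-e i j k i i) (cong₂ _-_ (e-row i j) (e-col k≢l))
  ... | no _ | yes refl = ¬Trit[-2] (subst Trit vⱼ≡-2 (lookup⁺ trits j))
    where
    vⱼ≡-2 : lookup (e i j -ᵥ e j l) j ≡ -[1+ 1 ]
    vⱼ≡-2 = trans (lookup-e-e i j j l j) (cong₂ _-_ (e-col i≢j) (e-row j l))
  ... | no _ | no j≢k =
    let _ , _ , only = count≡1⇒∃! (ℤ._≟ -1ℤ) (e i j -ᵥ e k l) minus-ones
    in j≢k (trans (sym (only vⱼ≡-1)) (only vₖ≡-1))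
    where
    vⱼ≡-1 : lookup (e i j -ᵥ e k l) j ≡ -1ℤ
    vⱼ≡-1 = trans (lookup-e-e i j k l j) (cong₂ _-_ (e-col i≢j) (e-elsewhere j≢k j≢l))
    vₖ≡-1 : lookup (e i j -ᵥ e k l) k ≡ -1ℤ
    vₖ≡-1 = trans (lookup-e-e i j k l k)
                  (cong₂ _-_ (e-elsewhere (i≢k ∘ sym) (j≢k ∘ sym)) (e-row k l))

  IsH-e-e⇔ : ∀ {i j k l} → i ≢ j → k ≢ l → ¬ (i ≡ k × j ≡ l) →
             IsH (e i j -ᵥ e k l) ⇔ (i ≡ k ⊎ j ≡ l)
  IsH-e-e⇔ {i} {j} {k} {l} i≢j k≢l different = mk⇔ sameLine isH
    where
    sameLine : IsH (e i j -ᵥ e k l) → i ≡ k ⊎ j ≡ l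
    sameLine h with i ≟ k | j ≟ l
    ... | yes i≡k | _       = inj₁ i≡k
    ... | no _    | yes j≡l = inj₂ j≡l
    ... | no i≢k  | no j≢l  = ⊥-elim (¬IsH-e-e i≢j k≢l i≢k j≢l h)

    isH : i ≡ k ⊎ j ≡ l → IsH (e i j -ᵥ e k l)
    isH (inj₁ refl) = subst IsH (sym (e-e-sameRow i≢j k≢l l≢j)) (IsH-e l≢j)
      where
      l≢j : l ≢ j
      l≢j refl = different (refl , refl)
    isH (inj₂ refl) = subst IsH (sym (e-e-sameCol i≢j i≢k k≢l)) (IsH-e i≢k)
      where
      i≢k : i ≢ k
      i≢k refl = different (refl , refl)

DifferInH : ∀ {d} → H d → H d → Set
DifferInH (a , _) (b , _) = IsH (a -ᵥ b) ⊎ IsH (b -ᵥ a)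

Rook≅G : ∀ d → Rook d ≅ G d
Rook≅G d = cells↔H , distinct×⇔ cells↔H {Q = DifferInH} sameLine⇔differInH
  where
  toH : OffDiagonal d → H d
  toH (i , j , i≢j) = e i j , IsH-e i≢j

  fromH : H d → OffDiagonal d
  fromH (_ , h) = let i , j , i≢j , _ = IsH⇒≡e h in i , j , i≢j

  toH∘fromH : ∀ a → toH (fromH a) ≡ a
  toH∘fromH (_ , h) = let _ , _ , _ , v≡e = IsH⇒≡e h in H-≡ (sym v≡e)

  fromH∘toH : ∀ p → fromH (toH p) ≡ p
  fromH∘toH (_ , _ , i≢j) =
    let _ , _ , _ , e≡e = IsH⇒≡e (IsH-e i≢j)
        i≡k , j≡l = e-injective i≢j e≡e
    in OffDiagonal-≡ (sym i≡k) (sym j≡l)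

  cells↔H : OffDiagonal d ↔ H d
  cells↔H = mk↔ₛ′ toH fromH toH∘fromH fromH∘toH

  sameLine⇔differInH : ∀ {p q} → p ≢ q → SameLine p q ⇔ DifferInH (toH p) (toH q)
  sameLine⇔differInH {i , j , i≢j} {k , l , k≢l} p≢q =
    mk⇔ (inj₁ ∘ Equivalence.from pq)
        [ Equivalence.to pq , map-⊎ sym sym ∘ Equivalence.to qp ]
    where
    pq = IsH-e-e⇔ i≢j k≢l λ { (refl , refl) → p≢q refl }
    qp = IsH-e-e⇔ k≢l i≢j λ { (refl , refl) → p≢q refl }

module _ {d : ℕ} where

  left right : Fin d → Fin (d + d)
  left i = i ↑ˡ d
  right j = d ↑ʳ j

  left<right : ∀ i j → left i <ᶠ right j
  left<right i j rewrite toℕ-↑ˡ i d | toℕ-↑ʳ d j = ℕ.<-≤-trans (toℕ<n i) (ℕ.m≤m+n d (toℕ j))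

  left≢right : ∀ {i j} → left i ≢ right j
  left≢right {i} {j} eq = <-irrefl eq (left<right i j)

  CrownEdge : Set
  CrownEdge = Edge (CrownAdj d)

  crownEdge : OffDiagonal d → CrownEdge
  crownEdge (i , j , i≢j) =
    left i , right j , left<right i j ,
    subst₂ CrownAdj′ (sym (splitAt-↑ˡ d i d)) (sym (splitAt-↑ʳ d d j)) i≢j

  crownEdge-surjective : ∀ (x : CrownEdge) →
    Σ[ (i , j , _) ∈ OffDiagonal d ] src x ≡ left i × tgt x ≡ right j
  crownEdge-surjective (x , y , x<y , adj) with splitAt d x in sx | splitAt d y in sy
  ... | inj₁ i | inj₂ j = (i , j , adj) , sym (splitAt⁻¹-↑ˡ sx) , sym (splitAt⁻¹-↑ʳ sy)
  ... | inj₁ _ | inj₁ _ = ⊥-elim adj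
  ... | inj₂ _ | inj₂ _ = ⊥-elim adj
  ... | inj₂ j | inj₁ i = ⊥-elim (<-asym x<y y<x)
    where
    y<x : y <ᶠ x
    y<x rewrite sym (splitAt⁻¹-↑ˡ sy) | sym (splitAt⁻¹-↑ʳ sx) = left<right i j

  CrownAdj′-irrelevant : ∀ s t → Irrelevant (CrownAdj′ {d} s t)
  CrownAdj′-irrelevant (inj₁ _) (inj₁ _) _ _ = refl
  CrownAdj′-irrelevant (inj₁ _) (inj₂ _) _ _ = refl
  CrownAdj′-irrelevant (inj₂ _) (inj₁ _) _ _ = refl
  CrownAdj′-irrelevant (inj₂ _) (inj₂ _) _ _ = refl

  CrownEdge-≡ : ∀ {x y : CrownEdge} → src x ≡ src y → tgt x ≡ tgt y → x ≡ y
  CrownEdge-≡ {s , t , s<t , adj} {.s , .t , s<t′ , adj′} refl refl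
    rewrite <-irrelevant s<t s<t′
          | CrownAdj′-irrelevant (splitAt d s) (splitAt d t) adj adj′ = refl

Rook≅LineCrown : ∀ d → Rook d ≅ LineCrown d
Rook≅LineCrown d =
  cells↔edges ,
  distinct×⇔ cells↔edges {Q = ShareEndpoint} λ {p} {q} _ → sameLine⇔shareEndpoint p q
  where
  cell : CrownEdge → OffDiagonal d
  cell = proj₁ ∘ crownEdge-surjective

  crownEdge∘cell : ∀ x → crownEdge (cell x) ≡ x
  crownEdge∘cell x = let _ , s≡ , t≡ = crownEdge-surjective x in CrownEdge-≡ (sym s≡) (sym t≡)

  cell∘crownEdge : ∀ p → cell (crownEdge p) ≡ p
  cell∘crownEdge (i , j , _) =
    let _ , left≡ , right≡ = crownEdge-surjective (crownEdge (i , j , _))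
    in OffDiagonal-≡ (sym (↑ˡ-injective d _ _ left≡)) (sym (↑ʳ-injective d _ _ right≡))

  cells↔edges : OffDiagonal d ↔ CrownEdge
  cells↔edges = mk↔ₛ′ crownEdge cell crownEdge∘cell cell∘crownEdge

  sameLine⇔shareEndpoint : ∀ p q → SameLine p q ⇔ ShareEndpoint (crownEdge p) (crownEdge q)
  sameLine⇔shareEndpoint (i , j , _) (k , l , _) = mk⇔
    [ inj₁ ∘ cong left , inj₂ ∘ inj₂ ∘ inj₂ ∘ cong right ]
    λ { (inj₁ i≡k)               → inj₁ (↑ˡ-injective d i k i≡k)
      ; (inj₂ (inj₁ i≡l))        → ⊥-elim (left≢right i≡l)
      ; (inj₂ (inj₂ (inj₁ j≡k))) → ⊥-elim (left≢right (sym j≡k))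
      ; (inj₂ (inj₂ (inj₂ j≡l))) → inj₂ (↑ʳ-injective d j l j≡l) }

-- The isomorphism exists for every d.
proposition6 : (d : ℕ) → 3 ≤ d → G d ≅ LineCrown d
proposition6 d _ =
  ≅-trans {G d} {Rook d} {LineCrown d} (≅-sym {Rook d} {G d} (Rook≅G d)) (Rook≅LineCrown d)
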